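{- Let $G^\sigma$ be a $4$-regular oriented graph with skew-adjacency matrix $S(G^\sigma)$, and let $G$ be its underlying graph. If $S(G^\sigma)^TS(G^\sigma)=4I$, then $|N(u)\cap N(v)|\in\{0,2\}$ for any two adjacent vertices $u,v$ of $G$, and $|N(u)\cap N(v)|\in\{0,2,4\}$ for any two distinct non-adjacent vertices $u,v$ of $G$.
   Context: For a simple undirected graph $G$ with vertices $v_1,\dots,v_n$, an orientation $\sigma$ assigns a direction to each edge, giving an oriented graph $G^\sigma$ with underlying graph $G$. The skew-adjacency matrix $S(G^\sigma)=[s_{ij}]$ is the $n\times n$ matrix with $s_{ij}=1$ and $s_{ji}=-1$ if $\langle v_i,v_j\rangle$ is an arc of $G^\sigma$, and $s_{ij}=s_{ji}=0$ otherwise. $N(x)$ denotes the neighborhood of $x$ in $G$. -}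

module Defs where

open import Data.Nat using (ℕ; zero; suc)
open import Data.Bool using (Bool; true; false; _∨_; _∧_; not; if_then_else_)
open import Data.Fin using (Fin; _≟_)
open import Data.Integer using (ℤ; +_; -_; _+_; _*_)
open import Data.Product using (_×_)
open import Data.Empty using (⊥)
open import Relation.Binary.PropositionalEquality using (_≡_)
open import Relation.Nullary.Decidable using (⌊_⌋)

sumℕ : (n : ℕ) → (Fin n → ℕ) → ℕ
sumℕ zero    f = 0
sumℕ (suc n) f = f Fin.zero Data.Nat.+ sumℕ n (λ i → f (Fin.suc i))
  where import Data.Fin as Fin
sumℤ : (n : ℕ) → (Fin n → ℤ) → ℤ
sumℤ zero    f = + 0
sumℤ (suc n) f = f Fin.zero + sumℤ n (λ i → f (Fin.suc i))
  where import Data.Fin as Fin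

-- An oriented graph on vertex set {v_1..v_n} = Fin n:
-- arc i j = true  iff  ⟨v_i , v_j⟩ is an arc.
-- No loops, and at most one direction per edge (it is an orientation
-- of a simple graph).
record OrientedGraph (n : ℕ) : Set where
  field
    arc        : Fin n → Fin n → Bool
    irreflexive : ∀ i → arc i i ≡ false
    antisym     : ∀ i j → arc i j ≡ true → arc j i ≡ false
open OrientedGraph public

adj : ∀ {n} → OrientedGraph n → Fin n → Fin n → Bool
adj G i j = arc G i j ∨ arc G j i

skew : ∀ {n} → OrientedGraph n → Fin n → Fin n → ℤ
skew G i j with arc G i j | arc G j i
... | true  | _     = + 1
... | false | true  = - (+ 1)
... | false | false = + 0

idℤ : ∀ {n} → Fin n → Fin n → ℤ
idℤ i j = if ⌊ i ≟ j ⌋ then + 1 else + 0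

StS : ∀ {n} → OrientedGraph n → Fin n → Fin n → ℤ
StS {n} G i j = sumℤ n (λ k → skew G k i * skew G k j)

degree : ∀ {n} → OrientedGraph n → Fin n → ℕ
degree {n} G i = sumℕ n (λ k → if adj G i k then 1 else 0)

Regular : ∀ {n} → ℕ → OrientedGraph n → Set
Regular r G = ∀ i → degree G i ≡ r

commonNbrs : ∀ {n} → OrientedGraph n → Fin n → Fin n → ℕ
commonNbrs {n} G u v = sumℕ n (λ k → if adj G u k ∧ adj G v k then 1 else 0)

module Submission where

-- For distinct vertices u, v the hypothesis SᵀS = 4I gives
--   0 = (SᵀS)_{uv} = Σ_k S_{ku} S_{kv}.
-- The term S_{ku} S_{kv} is ±1 exactly when k is a common neighbour of u and v
-- and 0 otherwise, so the common neighbours split into a positive and a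
-- negative class whose sizes a, b satisfy a − b = 0; hence |N(u) ∩ N(v)| = 2a
-- is even.  Moreover N(u) ∩ N(v) ⊆ N(u) has at most deg u = 4 elements, and
-- when u ~ v it misses v ∈ N(u), so it has at most 3.  An even number ≤ 4 lies
-- in {0,2,4}, and an even number < 4 lies in {0,2}.

open import Defs
open import Data.Nat using (ℕ; zero; suc; _≤_; _<_; z≤n; s≤s)
import Data.Nat as ℕ
import Data.Nat.Properties as ℕP
open import Data.Fin using (Fin; _≟_)
import Data.Fin as Fin
open import Data.Bool using (Bool; true; false; _∧_; if_then_else_)
open import Data.Integer using (ℤ; +_; -_; _-_)
import Data.Integer as ℤ
import Data.Integer.Properties as ℤP
open import Data.Integer.Solver using (module +-*-Solver)
open import Data.Sum using (_⊎_; inj₁; inj₂)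
open import Data.Product using (Σ; _×_; _,_)
open import Data.Empty using (⊥-elim)
open import Relation.Binary.PropositionalEquality
  using (_≡_; _≢_; refl; sym; trans; cong)
open import Relation.Nullary using (yes; no)

indicator : Bool → ℕ
indicator b = if b then 1 else 0

Even : ℕ → Set
Even m = Σ ℕ λ a → m ≡ a ℕ.+ a

data Signed : ℤ → Bool → Set where
  zero  : Signed (+ 0) false
  plus  : Signed (+ 1) true
  minus : Signed (- (+ 1)) true

Signed-* : ∀ {x y p q} → Signed x p → Signed y q → Signed (x ℤ.* y) (p ∧ q)
Signed-* zero  _     = zero
Signed-* plus  zero  = zero
Signed-* plus  plus  = plus
Signed-* plus  minus = minus
Signed-* minus zero  = zero
Signed-* minus plus  = minus
Signed-* minus minus = plus

plus-step : ∀ a b → + 1 ℤ.+ (+ a - + b) ≡ + suc a - + b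
plus-step a b = sym (ℤP.+-assoc (+ 1) (+ a) (- (+ b)))

minus-step : ∀ a b → - (+ 1) ℤ.+ (+ a - + b) ≡ + a - + suc b
minus-step a b = identity (+ a) (+ b)
  where
  open +-*-Solver
  identity : ∀ (x y : ℤ) → - (+ 1) ℤ.+ (x - y) ≡ x - (+ 1 ℤ.+ y)
  identity = solve 2 (λ x y → con (- (+ 1)) :+ (x :- y) := x :- (con (+ 1) :+ y)) refl

-- A sum of signed indicators equals a − b, where a and b count the +1 and −1
-- terms, while the number of nonzero terms is a + b.
signed-sum : ∀ n (t : Fin n → ℤ) (c : Fin n → Bool) → (∀ k → Signed (t k) (c k)) →
  Σ ℕ λ a → Σ ℕ λ b →
    (sumℕ n (λ k → indicator (c k)) ≡ a ℕ.+ b) × (sumℤ n t ≡ + a - + b)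
signed-sum zero t c s = 0 , 0 , refl , refl
signed-sum (suc n) t c s
  with signed-sum n (λ k → t (Fin.suc k)) (λ k → c (Fin.suc k)) (λ k → s (Fin.suc k))
     | t Fin.zero | c Fin.zero | s Fin.zero
... | a , b , count , total | _ | _ | zero =
  a , b , count , trans (ℤP.+-identityˡ _) total
... | a , b , count , total | _ | _ | plus =
  suc a , b , cong suc count , trans (cong (λ x → + 1 ℤ.+ x) total) (plus-step a b)
... | a , b , count , total | _ | _ | minus =
  a , suc b , trans (cong suc count) (sym (ℕP.+-suc a b)) ,
  trans (cong (λ x → - (+ 1) ℤ.+ x) total) (minus-step a b)

vanishing-signed-sum-even : ∀ n (t : Fin n → ℤ) (c : Fin n → Bool) →
  (∀ k → Signed (t k) (c k)) → sumℤ n t ≡ + 0 →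
  Even (sumℕ n (λ k → indicator (c k)))
vanishing-signed-sum-even n t c s vanish with signed-sum n t c s
... | a , b , count , total = a , trans count (cong (a ℕ.+_) b≡a)
  where
  b≡a : b ≡ a
  b≡a = sym (ℤP.+-injective (ℤP.i-j≡0⇒i≡j (+ a) (+ b) (trans (sym total) vanish)))

sum-mono : ∀ n (c d : Fin n → ℕ) → (∀ k → c k ≤ d k) → sumℕ n c ≤ sumℕ n d
sum-mono zero    c d le = z≤n
sum-mono (suc n) c d le =
  ℕP.+-mono-≤ (le Fin.zero) (sum-mono n _ _ (λ k → le (Fin.suc k)))

sum-strict-mono : ∀ n (c d : Fin n → ℕ) → (∀ k → c k ≤ d k) →
  ∀ j → c j < d j → sumℕ n c < sumℕ n d
sum-strict-mono (suc n) c d le Fin.zero lt =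
  ℕP.+-mono-≤ lt (sum-mono n _ _ (λ k → le (Fin.suc k)))
sum-strict-mono (suc n) c d le (Fin.suc j) lt =
  ℕP.≤-trans (ℕP.≤-reflexive (sym (ℕP.+-suc (c Fin.zero) _)))
    (ℕP.+-mono-≤ (le Fin.zero) (sum-strict-mono n _ _ (λ k → le (Fin.suc k)) j lt))

indicator-∧ : ∀ p q → indicator (p ∧ q) ≤ indicator p
indicator-∧ false q     = z≤n
indicator-∧ true  false = z≤n
indicator-∧ true  true  = s≤s z≤n

even≤4 : ∀ {m} → Even m → m ≤ 4 → m ≡ 0 ⊎ m ≡ 2 ⊎ m ≡ 4
even≤4 (0 , refl) _ = inj₁ refl
even≤4 (1 , refl) _ = inj₂ (inj₁ refl)
even≤4 (2 , refl) _ = inj₂ (inj₂ refl)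
even≤4 (suc (suc (suc a)) , refl) (s≤s (s≤s (s≤s le)))
  with ℕP.m+n≤o⇒n≤o a le
... | s≤s ()

even<4 : ∀ {m} → Even m → m < 4 → m ≡ 0 ⊎ m ≡ 2
even<4 ev lt with even≤4 ev (ℕP.<⇒≤ lt)
... | inj₁ m≡0        = inj₁ m≡0
... | inj₂ (inj₁ m≡2) = inj₂ m≡2
... | inj₂ (inj₂ refl) = ⊥-elim (ℕP.<-irrefl refl lt)

skew-signed : ∀ {n} (G : OrientedGraph n) u k → Signed (skew G k u) (adj G u k)
skew-signed G u k with arc G k u | arc G u k
... | true  | true  = plus
... | true  | false = plus
... | false | true  = minus
... | false | false = zero

adj-irreflexive : ∀ {n} (G : OrientedGraph n) v → adj G v v ≡ false
adj-irreflexive G v rewrite irreflexive G v = refl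

adj⇒≢ : ∀ {n} (G : OrientedGraph n) u v → adj G u v ≡ true → u ≢ v
adj⇒≢ G u v u~v refl with trans (sym u~v) (adj-irreflexive G u)
... | ()

orthogonal⇒even : ∀ {n} (G : OrientedGraph n) u v → StS G u v ≡ + 0 →
  Even (commonNbrs G u v)
orthogonal⇒even {n} G u v =
  vanishing-signed-sum-even n (λ k → skew G k u ℤ.* skew G k v)
    (λ k → adj G u k ∧ adj G v k)
    (λ k → Signed-* (skew-signed G u k) (skew-signed G v k))

-- |N(u) ∩ N(v)| ≤ deg u, with strict inequality when v ∈ N(u) (as v ∉ N(v)).
common≤degree : ∀ {n} (G : OrientedGraph n) u v → commonNbrs G u v ≤ degree G u
common≤degree {n} G u v =
  sum-mono n _ _ (λ k → indicator-∧ (adj G u k) (adj G v k))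

common<degree : ∀ {n} (G : OrientedGraph n) u v → adj G u v ≡ true →
  commonNbrs G u v < degree G u
common<degree {n} G u v u~v =
  sum-strict-mono n _ _ (λ k → indicator-∧ (adj G u k) (adj G v k)) v at-v
  where
  at-v : indicator (adj G u v ∧ adj G v v) < indicator (adj G u v)
  at-v rewrite u~v | adj-irreflexive G v = s≤s z≤n

off-diagonal : ∀ {n} (G : OrientedGraph n) → (∀ i j → StS G i j ≡ (+ 4) ℤ.* idℤ i j) →
  ∀ u v → u ≢ v → StS G u v ≡ + 0
off-diagonal G ort u v u≢v with u ≟ v | ort u v
... | yes u≡v | _      = ⊥-elim (u≢v u≡v)
... | no _    | vanish = vanish

proposition2p2 : {n : ℕ} (G : OrientedGraph n) → Regular 4 G →
    (∀ i j → StS G i j ≡ (+ 4) ℤ.* idℤ i j) →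
    (∀ u v → adj G u v ≡ true →
      commonNbrs G u v ≡ 0 ⊎ commonNbrs G u v ≡ 2)
    × (∀ u v → u ≢ v → adj G u v ≡ false →
      commonNbrs G u v ≡ 0 ⊎ commonNbrs G u v ≡ 2 ⊎ commonNbrs G u v ≡ 4)
proposition2p2 G regular ort = adjacent , non-adjacent
  where
  even : ∀ u v → u ≢ v → Even (commonNbrs G u v)
  even u v u≢v = orthogonal⇒even G u v (off-diagonal G ort u v u≢v)

  adjacent : ∀ u v → adj G u v ≡ true →
    commonNbrs G u v ≡ 0 ⊎ commonNbrs G u v ≡ 2
  adjacent u v u~v =
    even<4 (even u v (adj⇒≢ G u v u~v))
      (ℕP.<-≤-trans (common<degree G u v u~v) (ℕP.≤-reflexive (regular u)))

  non-adjacent : ∀ u v → u ≢ v → adj G u v ≡ false →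
    commonNbrs G u v ≡ 0 ⊎ commonNbrs G u v ≡ 2 ⊎ commonNbrs G u v ≡ 4
  non-adjacent u v u≢v _ =
    even≤4 (even u v u≢v)
      (ℕP.≤-trans (common≤degree G u v) (ℕP.≤-reflexive (regular u)))
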